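{- Let $(W,S)$ be a finite Coxeter system, $A\subseteq T$, and assume $W=W_1\times W_2$ with $W_1,W_2$ standard parabolic subgroups. Then, under the identification $\mathbb{Z}W=\mathbb{Z}W_1\otimes_{\mathbb{Z}}\mathbb{Z}W_2$, $$\mathcal{D}_A(W)=\mathcal{D}_{A\cap W_1}(W_1)\otimes_{\mathbb{Z}}\mathcal{D}_{A\cap W_2}(W_2).$$
   Context: $\ell$ is the length function and $T=\{wsw^{ -1}\mid w\in W,s\in S\}$. For $A\subseteq T$ and $w\in W$, $D_A(w)=\{r\in A\mid\ell(wr)<\ell(w)\}$; $\mathcal{P}_{\mathrm{ad}}(A)$ is the set of $I\subseteq A$ with $I=D_A(w)$ for some $w$; for such $I$, $D_I^A=\{w\mid D_A(w)=I\}$, $d_I^A=\sum_{w\in D_I^A}w$, and $\mathcal{D}_A(W)=\bigoplus_{I\in\mathcal{P}_{\mathrm{ad}}(A)}\mathbb{Z}d_I^A\subseteq\mathbb{Z}W$. For $W_j$ (with Coxeter generators $S\cap W_j$) and $A\cap W_j$ the analogous module $\mathcal{D}_{A\cap W_j}(W_j)\subseteq\mathbb{Z}W_j$ is defined in the same way. -}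

module Defs where

open import Level using (0ℓ)
open import Data.Bool using (Bool; true)
open import Data.Nat using (ℕ; zero; suc; _≤_; _<_)
open import Data.Integer using (ℤ; +_; _+_; _*_)
open import Data.Fin using (Fin)
open import Data.List using (List; []; _∷_; length; foldr)
open import Data.List.Relation.Unary.All using (All)
open import Data.Product using (Σ; ∃; _×_; _,_; proj₁; proj₂)
open import Relation.Nullary using (¬_)
open import Relation.Binary.PropositionalEquality using (_≡_; _≢_)
open import Algebra.Bundles using (Group)
open import Function.Bundles using (_⇔_)

record FinGroup : Set₁ where
  infixl 7 _·_
  field
    W      : Set
    _·_    : W → W → W
    e      : W
    inv    : W → W
    assoc  : ∀ x y z → (x · y) · z ≡ x · (y · z)
    idˡ    : ∀ x → e · x ≡ x
    idʳ    : ∀ x → x · e ≡ x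
    invˡ   : ∀ x → inv x · x ≡ e
    invʳ   : ∀ x → x · inv x ≡ e
    size   : ℕ
    enum   : Fin size → W
    index  : W → Fin size
    enum-index : ∀ x → enum (index x) ≡ x
    index-enum : ∀ i → index (enum i) ≡ i

∑ : (n : ℕ) → (Fin n → ℤ) → ℤ
∑ zero    f = + 0
∑ (suc n) f = f Fin.zero + ∑ n (λ i → f (Fin.suc i))

gpow : (H : Group 0ℓ 0ℓ) → Group.Carrier H → ℕ → Group.Carrier H
gpow H x zero    = Group.ε H
gpow H x (suc m) = Group._∙_ H x (gpow H x m)

module _ (G : FinGroup) where
  open FinGroup G

  Pred : Set₁
  Pred = W → Set

  _∈ᵇ_ : W → (W → Bool) → Set
  x ∈ᵇ X = X x ≡ true

  prod : List W → W
  prod = foldr _·_ e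

  pow : W → ℕ → W
  pow x zero    = e
  pow x (suc m) = x · pow x m

  IsOrder : W → ℕ → Set
  IsOrder x m = (0 < m) × (pow x m ≡ e) × (∀ k → 0 < k → pow x k ≡ e → m ≤ k)

  IsProductOf : Pred → W → ℕ → Set
  IsProductOf X w k = Σ (List W) λ ws → All X ws × length ws ≡ k × prod ws ≡ w

  HasLength : Pred → W → ℕ → Set
  HasLength X w k = IsProductOf X w k × (∀ m → IsProductOf X w m → k ≤ m)

  Shorter : Pred → W → W → Set
  Shorter X u w = Σ ℕ λ m → Σ ℕ λ n → HasLength X u m × HasLength X w n × m < n

  -- membership in the subgroup generated by X (standard parabolic W_J for X = J ⊆ S)
  InGen : Pred → W → Set
  InGen X w = Σ ℕ λ k → IsProductOf X w k

  record IsCoxeterSystem (S : W → Bool) : Set₁ where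
    field
      generates : ∀ w → InGen (_∈ᵇ S) w
      involution : ∀ s → s ∈ᵇ S → (s · s ≡ e) × (s ≢ e)
      presentation :
        (H : Group 0ℓ 0ℓ) (f : W → Group.Carrier H) →
        (∀ s t → s ∈ᵇ S → t ∈ᵇ S → ∀ m → IsOrder (s · t) m →
           Group._≈_ H (gpow H (Group._∙_ H (f s) (f t)) m) (Group.ε H)) →
        Σ (W → Group.Carrier H) λ φ →
          (∀ x y → Group._≈_ H (φ (x · y)) (Group._∙_ H (φ x) (φ y))) ×
          (∀ s → s ∈ᵇ S → Group._≈_ H (φ s) (f s))

  IsReflection : (S : W → Bool) → W → Set
  IsReflection S r = Σ W λ w → Σ W λ s → s ∈ᵇ S × r ≡ w · s · inv w

  InternalDirectProduct : Pred → Pred → Set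
  InternalDirectProduct U₁ U₂ =
    (∀ x y → U₁ x → U₂ y → x · y ≡ y · x) ×
    (∀ x → U₁ x → U₂ x → x ≡ e) ×
    (∀ w → Σ W λ x → Σ W λ y → U₁ x × U₂ y × w ≡ x · y)

  -- Descent machinery for a Coxeter system (U, X) inside W: U is the
  -- underlying group (a subgroup of W), X its Coxeter generators, A the
  -- chosen set of reflections, length taken w.r.t. X.
  DescentIs : (X A : Pred) → W → Pred → Set
  DescentIs X A w I = ∀ r → I r ⇔ (A r × Shorter X (w · r) w)

  Admissible : (X U A : Pred) → Pred → Set
  Admissible X U A I = Σ W λ w → U w × DescentIs X A w I

  -- g = d_I^A as an element of ℤU ⊆ ℤW (functions W → ℤ supported on U)
  IsDescentClassSum : (X U A : Pred) → Pred → (W → ℤ) → Set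
  IsDescentClassSum X U A I g = ∀ w →
    (U w → DescentIs X A w I → g w ≡ + 1) ×
    (U w → ¬ DescentIs X A w I → g w ≡ + 0) ×
    (¬ U w → g w ≡ + 0)

  DescentGenerator : (X U A : Pred) → (W → ℤ) → Set₁
  DescentGenerator X U A g = Σ Pred λ I → Admissible X U A I × IsDescentClassSum X U A I g

  lincomb : {Gen : (W → ℤ) → Set₁} → List (ℤ × Σ (W → ℤ) Gen) → W → ℤ
  lincomb []                  w = + 0
  lincomb ((c , g , _) ∷ cs) w = c * g w + lincomb cs w

  Span : ((W → ℤ) → Set₁) → (W → ℤ) → Set₁
  Span Gen f = Σ (List (ℤ × Σ (W → ℤ) Gen)) λ cs → ∀ w → f w ≡ lincomb cs w

  DescentModule : (X U A : Pred) → (W → ℤ) → Set₁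
  DescentModule X U A = Span (DescentGenerator X U A)

  conv : (W → ℤ) → (W → ℤ) → W → ℤ
  conv f g w = ∑ size (λ i → f (enum i) * g (inv (enum i) · w))

  -- image of M₁ ⊗_ℤ M₂ in ℤW under ℤW₁ ⊗ ℤW₂ ≅ ℤW, x ⊗ y ↦ x y
  TensorImage : ((W → ℤ) → Set₁) → ((W → ℤ) → Set₁) → (W → ℤ) → Set₁
  TensorImage M₁ M₂ = Span (λ h → Σ (W → ℤ) λ f₁ → Σ (W → ℤ) λ f₂ →
                                     M₁ f₁ × M₂ f₂ × (∀ w → h w ≡ conv f₁ f₂ w))

-- Each simple reflection s lies in W₁ or W₂: the Coxeter presentation turns "is conjugate to s"
-- on S into a homomorphism W → ℤ₂, so if s = w₁w₂ with wᵢ a word in Jᵢ, some letter of w₁w₂ is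
-- conjugate to s, and normality of the factor containing that letter puts s in it. Hence the
-- reflections lie in the factors too, S-words split into words in S ∩ W₁ and S ∩ W₂, and
-- ℓ(w₁w₂) = ℓ₁(w₁) + ℓ₂(w₂). So the descent set of w₁w₂ is the disjoint union of those of w₁ and
-- w₂, every descent class of W is the product of one of W₁ and one of W₂, and
-- d_I = d_{I ∩ W₁} · d_{I ∩ W₂} in ℤW; both inclusions follow by bilinearity of the product of ℤW.

{-# OPTIONS --safe #-}
module Submission where

open import Defs
open import Level using (0ℓ)
open import Algebra.Bundles using (Group; AbelianGroup; CommutativeRing)
import Algebra.Properties.Group as GroupProperties
open import Data.Bool as Bool using (Bool; true; false; _xor_)
open import Data.Bool.Properties using (xor-∧-commutativeRing; xor-same; xor-identityʳ)
open import Data.Empty using (⊥-elim)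
open import Data.Fin as Fin using (Fin)
import Data.Fin.Properties as FinP
open import Data.Integer as ℤ using (ℤ; +_)
import Data.Integer.Properties as ℤP
open import Data.Integer.Solver using (module +-*-Solver)
open import Data.List using (List; []; _∷_; _++_; length)
open import Data.List.Properties using (length-++)
open import Data.List.Relation.Unary.All as All using (All; []; _∷_)
import Data.List.Relation.Unary.All.Properties as AllP
open import Data.List.Relation.Unary.Any as Any using (Any; here; there)
import Data.List.Relation.Unary.Any.Properties as AnyP
open import Data.Nat using (ℕ; zero; suc; _+_; _≤_; _<_)
open import Data.Nat.Induction using (<-rec)
import Data.Nat.Properties as ℕP
open import Data.Product using (Σ; ∃; _×_; _,_; proj₁; proj₂)
open import Data.Sum as Sum using (_⊎_; inj₁; inj₂; [_,_]′)
open import Data.Unit using (⊤; tt)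
open import Function using (_∘_; id)
open import Function.Bundles using (_⇔_; mk⇔; Equivalence)
import Function.Properties.Equivalence as ⇔
open import Relation.Binary.Definitions using (DecidableEquality)
open import Relation.Binary.PropositionalEquality
open import Relation.Nullary using (¬_; Dec; yes; no; does; contradiction)
open import Relation.Nullary.Decidable using (map′; _×-dec_; decidable-stable; ¬¬-excluded-middle; dec-true; dec-false; does-⇔)
open import Relation.Unary using (Decidable)
open import Algebra.Properties.Semiring.Sum ℤP.+-*-semiring
  using (sum; sum-cong-≗; sum-remove; sum-replicate-zero; ∑-distrib-+; *-distribˡ-sum)

open Equivalence using (to; from)

ℤ₂ : Group 0ℓ 0ℓ
ℤ₂ = AbelianGroup.group (CommutativeRing.+-abelianGroup xor-∧-commutativeRing)

gpow-false : ∀ m → gpow ℤ₂ false m ≡ false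
gpow-false zero    = refl
gpow-false (suc m) = gpow-false m

gpow-double : ∀ b k → gpow ℤ₂ b (k + k) ≡ false
gpow-double b zero    = refl
gpow-double b (suc k) rewrite ℕP.+-suc k k | gpow-double b k =
  trans (cong (b xor_) (xor-identityʳ b)) (xor-same b)

even-or-odd : ∀ m → (∃ λ k → m ≡ k + k) ⊎ (∃ λ k → m ≡ suc (k + k))
even-or-odd zero = inj₁ (0 , refl)
even-or-odd (suc m) with even-or-odd m
... | inj₁ (k , refl) = inj₂ (k , refl)
... | inj₂ (k , refl) = inj₁ (suc k , cong suc (sym (ℕP.+-suc k k)))

least : ∀ {P : ℕ → Set} → Decidable P → ∀ {k} → P k → Σ ℕ λ m → P m × (∀ j → P j → m ≤ j)
least {P} P? {k} = <-rec (λ k → P k → Σ ℕ λ m → P m × (∀ j → P j → m ≤ j)) step k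
  where
  step : ∀ k → (∀ {j} → j < k → P j → Σ ℕ λ m → P m × (∀ j → P j → m ≤ j)) →
         P k → Σ ℕ λ m → P m × (∀ j → P j → m ≤ j)
  step k smaller Pk with ℕP.anyUpTo? P? k
  ... | yes (j , j<k , Pj) = smaller j<k Pj
  ... | no  none           = k , Pk , λ j Pj → ℕP.≮⇒≥ (λ j<k → none (j , j<k , Pj))

Indicates : Set → ℤ → Set
Indicates P z = (P → z ≡ + 1) × (¬ P → z ≡ + 0)

-- P need not be decidable: equality in ℤ is, so it is stable under double negation.
≡-by-cases : ∀ (P : Set) {x y : ℤ} → (P → x ≡ y) → (¬ P → x ≡ y) → x ≡ y
≡-by-cases P {x} {y} if-P if-¬P = decidable-stable (x ℤ.≟ y) λ x≢y →
  ¬¬-excluded-middle λ { (yes p) → x≢y (if-P p) ; (no ¬p) → x≢y (if-¬P ¬p) }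

Indicates-unique : ∀ {P x y} → Indicates P x → Indicates P y → x ≡ y
Indicates-unique {P} (x₁ , x₀) (y₁ , y₀) =
  ≡-by-cases P (λ p → trans (x₁ p) (sym (y₁ p))) (λ ¬p → trans (x₀ ¬p) (sym (y₀ ¬p)))

Indicates-× : ∀ {P Q x y} → Indicates P x → Indicates Q y → Indicates (P × Q) (x ℤ.* y)
Indicates-× {P} {Q} {x} {y} (x₁ , x₀) (y₁ , y₀) =
  (λ (p , q) → cong₂ ℤ._*_ (x₁ p) (y₁ q)) ,
  λ ¬pq → ≡-by-cases P (λ p → trans (cong (x ℤ.*_) (y₀ (λ q → ¬pq (p , q)))) (ℤP.*-zeroʳ x))
                       (λ ¬p → cong (ℤ._* y) (x₀ ¬p))

Indicates-resp-⇔ : ∀ {P Q x} → P ⇔ Q → Indicates P x → Indicates Q x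
Indicates-resp-⇔ P⇔Q (x₁ , x₀) = x₁ ∘ from P⇔Q , λ ¬q → x₀ (¬q ∘ to P⇔Q)

restrict : ∀ {A : Set} {U : A → Set} → Decidable U → (A → ℤ) → A → ℤ
restrict U? f x = Bool.if does (U? x) then f x else + 0

restrict-∈ : ∀ {A : Set} {U : A → Set} (U? : Decidable U) f {x} → U x → restrict U? f x ≡ f x
restrict-∈ U? f {x} u with U? x
... | yes _ = refl
... | no ¬u = contradiction u ¬u

restrict-∉ : ∀ {A : Set} {U : A → Set} (U? : Decidable U) f {x} → ¬ U x → restrict U? f x ≡ + 0
restrict-∉ U? f {x} ¬u with U? x
... | yes u = contradiction u ¬u
... | no _  = refl

∑≡sum : ∀ n (f : Fin n → ℤ) → ∑ n f ≡ sum f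
∑≡sum zero    f = refl
∑≡sum (suc n) f = cong (ℤ._+_ (f Fin.zero)) (∑≡sum n (f ∘ Fin.suc))

∑-cong : ∀ n {f g : Fin n → ℤ} → (∀ i → f i ≡ g i) → ∑ n f ≡ ∑ n g
∑-cong n {f} {g} f≗g rewrite ∑≡sum n f | ∑≡sum n g = sum-cong-≗ f≗g

∑-zero : ∀ n (f : Fin n → ℤ) → (∀ i → f i ≡ + 0) → ∑ n f ≡ + 0
∑-zero n f f≗0 rewrite ∑≡sum n f = trans (sum-cong-≗ f≗0) (sum-replicate-zero n)

∑-single : ∀ n (f : Fin n → ℤ) i → (∀ j → j ≢ i → f j ≡ + 0) → ∑ n f ≡ f i
∑-single (suc n) f i others≡0 rewrite ∑≡sum (suc n) f = begin
  sum f                                   ≡⟨ sum-remove f ⟩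
  f i ℤ.+ sum (λ j → f (Fin.punchIn i j)) ≡⟨ cong (ℤ._+_ (f i)) (sym (∑≡sum n _)) ⟩
  f i ℤ.+ ∑ n (λ j → f (Fin.punchIn i j)) ≡⟨ cong (ℤ._+_ (f i)) (∑-zero n _ (λ j → others≡0 _ (FinP.punchInᵢ≢i i j))) ⟩
  f i ℤ.+ + 0                             ≡⟨ ℤP.+-identityʳ (f i) ⟩
  f i                                     ∎
  where open ≡-Reasoning

∑-linear : ∀ n c (f g : Fin n → ℤ) → ∑ n (λ i → c ℤ.* f i ℤ.+ g i) ≡ c ℤ.* ∑ n f ℤ.+ ∑ n g
∑-linear n c f g rewrite ∑≡sum n (λ i → c ℤ.* f i ℤ.+ g i) | ∑≡sum n f | ∑≡sum n g =
  trans (∑-distrib-+ (λ i → c ℤ.* f i) g) (cong (ℤ._+ sum g) (sym (*-distribˡ-sum c f)))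

record IsSubgroup (G : FinGroup) (U : FinGroup.W G → Set) : Set where
  open FinGroup G
  field
    e-closed   : U e
    ·-closed   : ∀ {x y} → U x → U y → U (x · y)
    inv-closed : ∀ {x} → U x → U (inv x)

  prod-closed : ∀ {ws} → All U ws → U (prod G ws)
  prod-closed []         = e-closed
  prod-closed (u ∷ ws∈U) = ·-closed u (prod-closed ws∈U)

module FinGroupProperties (G : FinGroup) where
  open FinGroup G
  open ≡-Reasoning

  group : Group 0ℓ 0ℓ
  group = record
    { Carrier = W ; _≈_ = _≡_ ; _∙_ = _·_ ; ε = e ; _⁻¹ = inv
    ; isGroup = record
      { isMonoid = record
        { isSemigroup = record
          { isMagma = record { isEquivalence = isEquivalence ; ∙-cong = cong₂ _·_ }
          ; assoc = assoc }
        ; identity = idˡ , idʳ }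
      ; inverse = invˡ , invʳ
      ; ⁻¹-cong = cong inv } }

  open GroupProperties group public
    using ( ∙-cancelˡ; ∙-cancelʳ; inverseˡ-unique; inverseʳ-unique; ε⁻¹≈ε; ⁻¹-involutive; ⁻¹-anti-homo-∙
          ; \\-leftDividesˡ; \\-leftDividesʳ; //-rightDividesʳ)

  _≟_ : DecidableEquality W
  x ≟ y = map′ (λ i≡j → trans (sym (enum-index x)) (trans (cong enum i≡j) (enum-index y)))
               (cong index) (index x FinP.≟ index y)

  any? : ∀ {P : W → Set} → Decidable P → Dec (Σ W P)
  any? {P} P? = map′ (λ (i , p) → enum i , p) (λ (x , p) → index x , subst P (sym (enum-index x)) p)
                     (FinP.any? (P? ∘ enum))

  prod-++ : ∀ xs ys → prod G (xs ++ ys) ≡ prod G xs · prod G ys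
  prod-++ []       ys = sym (idˡ _)
  prod-++ (x ∷ xs) ys = trans (cong (x ·_) (prod-++ xs ys)) (sym (assoc _ _ _))

  pow-+ : ∀ x m n → pow G x (m + n) ≡ pow G x m · pow G x n
  pow-+ x zero    n = sym (idˡ _)
  pow-+ x (suc m) n = trans (cong (x ·_) (pow-+ x m n)) (sym (assoc _ _ _))

  pow-sucʳ : ∀ x k → pow G x (suc k) ≡ pow G x k · x
  pow-sucʳ x k = begin
    pow G x (suc k)             ≡⟨ cong (pow G x) (ℕP.+-comm 1 k) ⟩
    pow G x (k + 1)             ≡⟨ pow-+ x k 1 ⟩
    pow G x k · (x · e)         ≡⟨ cong (pow G x k ·_) (idʳ x) ⟩
    pow G x k · x               ∎

  pow-slide : ∀ x y k → x · pow G (y · x) k ≡ pow G (x · y) k · x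
  pow-slide x y zero    = trans (idʳ x) (sym (idˡ x))
  pow-slide x y (suc k) = begin
    x · ((y · x) · pow G (y · x) k)   ≡⟨ sym (assoc _ _ _) ⟩
    (x · (y · x)) · pow G (y · x) k   ≡⟨ cong (_· pow G (y · x) k) (sym (assoc x y x)) ⟩
    ((x · y) · x) · pow G (y · x) k   ≡⟨ assoc _ _ _ ⟩
    (x · y) · (x · pow G (y · x) k)   ≡⟨ cong ((x · y) ·_) (pow-slide x y k) ⟩
    (x · y) · (pow G (x · y) k · x)   ≡⟨ sym (assoc _ _ _) ⟩
    pow G (x · y) (suc k) · x         ∎

  pow-cancel : ∀ {x y} k → y · x ≡ e → pow G y k · pow G x k ≡ e
  pow-cancel         zero    yx≡e = idˡ e
  pow-cancel {x} {y} (suc k) yx≡e = begin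
    pow G y (suc k) · (x · pow G x k)   ≡⟨ cong (_· (x · pow G x k)) (pow-sucʳ y k) ⟩
    (pow G y k · y) · (x · pow G x k)   ≡⟨ assoc _ _ _ ⟩
    pow G y k · (y · (x · pow G x k))   ≡⟨ cong (pow G y k ·_) (sym (assoc y x _)) ⟩
    pow G y k · ((y · x) · pow G x k)   ≡⟨ cong (λ z → pow G y k · (z · pow G x k)) yx≡e ⟩
    pow G y k · (e · pow G x k)         ≡⟨ cong (pow G y k ·_) (idˡ _) ⟩
    pow G y k · pow G x k               ≡⟨ pow-cancel k yx≡e ⟩
    e                                   ∎

  Conjugate : W → W → Set
  Conjugate a b = Σ W λ g → g · a ≡ b · g

  Conjugate? : ∀ a b → Dec (Conjugate a b)
  Conjugate? a b = any? (λ g → (g · a) ≟ (b · g))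

  Conjugate-refl : ∀ a → Conjugate a a
  Conjugate-refl a = e , trans (idˡ a) (sym (idʳ a))

  Conjugate-sym : ∀ {a b} → Conjugate a b → Conjugate b a
  Conjugate-sym {a} {b} (g , ga≡bg) = inv g , (begin
    inv g · b                   ≡⟨ sym (//-rightDividesʳ g _) ⟩
    ((inv g · b) · g) · inv g   ≡⟨ cong (_· inv g) (assoc _ _ _) ⟩
    (inv g · (b · g)) · inv g   ≡⟨ cong (λ z → (inv g · z) · inv g) (sym ga≡bg) ⟩
    (inv g · (g · a)) · inv g   ≡⟨ cong (_· inv g) (\\-leftDividesʳ g a) ⟩
    a · inv g                   ∎)

  Conjugate-trans : ∀ {a b c} → Conjugate a b → Conjugate b c → Conjugate a c
  Conjugate-trans {a} {b} {c} (g , ga≡bg) (h , hb≡ch) = h · g , (begin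
    (h · g) · a   ≡⟨ assoc _ _ _ ⟩
    h · (g · a)   ≡⟨ cong (h ·_) ga≡bg ⟩
    h · (b · g)   ≡⟨ sym (assoc _ _ _) ⟩
    (h · b) · g   ≡⟨ cong (_· g) hb≡ch ⟩
    (c · h) · g   ≡⟨ assoc _ _ _ ⟩
    c · (h · g)   ∎)

  -- The conjugating element is (st)ᵏ: the braid relation (st)ᵏs = t(st)ᵏ of odd length 2k+1.
  odd-order⇒conjugate : ∀ {s t} k → s · s ≡ e → t · t ≡ e → pow G (s · t) (suc (k + k)) ≡ e →
                        Conjugate s t
  odd-order⇒conjugate {s} {t} k ss≡e tt≡e [st]²ᵏ⁺¹≡e = P , ∙-cancelʳ b a b (trans ab≡e (sym bb≡e))
    where
    P a b : W
    P = pow G (s · t) k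
    a = P · s
    b = t · P
    ab≡e : a · b ≡ e
    ab≡e = begin
      (P · s) · (t · P)          ≡⟨ assoc _ _ _ ⟩
      P · (s · (t · P))          ≡⟨ cong (P ·_) (sym (assoc _ _ _)) ⟩
      P · pow G (s · t) (suc k)  ≡⟨ sym (pow-+ (s · t) k (suc k)) ⟩
      pow G (s · t) (k + suc k)  ≡⟨ cong (pow G (s · t)) (ℕP.+-suc k k) ⟩
      pow G (s · t) (suc (k + k)) ≡⟨ [st]²ᵏ⁺¹≡e ⟩
      e                          ∎
    tsst≡e : (t · s) · (s · t) ≡ e
    tsst≡e = begin
      (t · s) · (s · t)   ≡⟨ assoc _ _ _ ⟩
      t · (s · (s · t))   ≡⟨ cong (t ·_) (sym (assoc _ _ _)) ⟩
      t · ((s · s) · t)   ≡⟨ cong (λ z → t · (z · t)) ss≡e ⟩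
      t · (e · t)         ≡⟨ cong (t ·_) (idˡ t) ⟩
      t · t               ≡⟨ tt≡e ⟩
      e                   ∎
    bb≡e : b · b ≡ e
    bb≡e = begin
      (t · P) · (t · P)                     ≡⟨ cong (_· (t · P)) (pow-slide t s k) ⟩
      (pow G (t · s) k · t) · (t · P)       ≡⟨ assoc _ _ _ ⟩
      pow G (t · s) k · (t · (t · P))       ≡⟨ cong (pow G (t · s) k ·_) (sym (assoc _ _ _)) ⟩
      pow G (t · s) k · ((t · t) · P)       ≡⟨ cong (λ z → pow G (t · s) k · (z · P)) tt≡e ⟩
      pow G (t · s) k · (e · P)             ≡⟨ cong (pow G (t · s) k ·_) (idˡ P) ⟩
      pow G (t · s) k · P                   ≡⟨ pow-cancel k tsst≡e ⟩
      e                                     ∎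

  Normal : (W → Set) → Set
  Normal U = ∀ g {u} → U u → U (g · u · inv g)

  Normal-conjugate : ∀ {U} → Normal U → ∀ {a b} → Conjugate a b → U b → U a
  Normal-conjugate {U} normal {a} {b} (g , ga≡bg) b∈U = subst U a≡g⁻¹bg (normal (inv g) b∈U)
    where
    a≡g⁻¹bg : inv g · b · inv (inv g) ≡ a
    a≡g⁻¹bg = begin
      inv g · b · inv (inv g)   ≡⟨ cong (inv g · b ·_) (⁻¹-involutive g) ⟩
      inv g · b · g             ≡⟨ assoc _ _ _ ⟩
      inv g · (b · g)           ≡⟨ cong (inv g ·_) (sym ga≡bg) ⟩
      inv g · (g · a)           ≡⟨ \\-leftDividesʳ g a ⟩
      a                         ∎

  InGen-isSubgroup : ∀ {X} → (∀ s → X s → s · s ≡ e) → IsSubgroup G (InGen G X)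
  InGen-isSubgroup {X} involution = record
    { e-closed = 0 , [] , [] , refl , refl ; ·-closed = ·-closed ; inv-closed = inv-closed }
    where
    ·-closed : ∀ {x y} → InGen G X x → InGen G X y → InGen G X (x · y)
    ·-closed (m , xs , xs∈X , refl , refl) (n , ys , ys∈X , refl , refl) =
      m + n , xs ++ ys , AllP.++⁺ xs∈X ys∈X , length-++ xs , prod-++ xs ys
    inv-word : ∀ {ws} → All X ws → InGen G X (inv (prod G ws))
    inv-word []                 = 0 , [] , [] , refl , sym ε⁻¹≈ε
    inv-word {s ∷ ws} (s∈X ∷ ws∈X) = subst (InGen G X) (begin
      inv (prod G ws) · s        ≡⟨ cong (inv (prod G ws) ·_) (inverseʳ-unique s s (involution s s∈X)) ⟩
      inv (prod G ws) · inv s    ≡⟨ sym (⁻¹-anti-homo-∙ s _) ⟩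
      inv (s · prod G ws)        ∎)
      (·-closed (inv-word ws∈X) (1 , s ∷ [] , s∈X ∷ [] , refl , idʳ s))
    inv-closed : ∀ {x} → InGen G X x → InGen G X (inv x)
    inv-closed (_ , ws , ws∈X , _ , refl) = inv-word ws∈X

  HasLength-unique : ∀ {X w m n} → HasLength G X w m → HasLength G X w n → m ≡ n
  HasLength-unique (wₘ , m-least) (wₙ , n-least) = ℕP.≤-antisym (m-least _ wₙ) (n-least _ wₘ)

  IsProductOf? : ∀ {X} → Decidable X → ∀ k w → Dec (IsProductOf G X w k)
  IsProductOf? X? zero w = map′
    (λ w≡e → [] , [] , refl , sym w≡e)
    (λ { ([] , _ , _ , e≡w) → sym e≡w })
    (w ≟ e)
  IsProductOf? {X} X? (suc k) w = map′
    (λ (s , s∈X , ws , ws∈X , len , s⁻¹w≡ws) →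
       s ∷ ws , s∈X ∷ ws∈X , cong suc len , trans (cong (s ·_) s⁻¹w≡ws) (\\-leftDividesˡ s w))
    (λ { (s ∷ ws , s∈X ∷ ws∈X , len , sws≡w) →
       s , s∈X , ws , ws∈X , ℕP.suc-injective len , trans (sym (\\-leftDividesʳ s _)) (cong (inv s ·_) sws≡w) })
    (any? (λ s → X? s ×-dec IsProductOf? X? k (inv s · w)))

  hasLength : ∀ {X w} → Decidable X → InGen G X w → Σ ℕ (HasLength G X w)
  hasLength {w = w} X? (_ , w∈Xᵏ) = least (λ k → IsProductOf? X? k w) w∈Xᵏ

module ClassSums (G : FinGroup) where
  open FinGroup G

  classSum-indicates : ∀ {X U A I g} → IsDescentClassSum G X U A I g →
                       ∀ {w} → U w → Indicates (DescentIs G X A w I) (g w)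
  classSum-indicates g-class {w} w∈U = proj₁ (g-class w) w∈U , proj₁ (proj₂ (g-class w)) w∈U

  classSum-vanishes : ∀ {X U A I g} → IsDescentClassSum G X U A I g → ∀ {w} → ¬ U w → g w ≡ + 0
  classSum-vanishes g-class {w} = proj₂ (proj₂ (g-class w))

  classSum-intro : ∀ {X U A I g} → (∀ {w} → U w → Indicates (DescentIs G X A w I) (g w)) →
                   (∀ {w} → ¬ U w → g w ≡ + 0) → IsDescentClassSum G X U A I g
  classSum-intro indicates vanishes w = proj₁ ∘ indicates , proj₂ ∘ indicates , vanishes

module SpanProperties (G : FinGroup) where
  open FinGroup G

  Combination : ((W → ℤ) → Set₁) → Set₁
  Combination Gen = List (ℤ × Σ (W → ℤ) Gen)

  scale : ∀ {Gen} → ℤ → Combination Gen → Combination Gen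
  scale c []                    = []
  scale c ((a , generator) ∷ cs) = (c ℤ.* a , generator) ∷ scale c cs

  lincomb-scale : ∀ {Gen} c (cs : Combination Gen) w → lincomb G (scale c cs) w ≡ c ℤ.* lincomb G cs w
  lincomb-scale c []                  w = sym (ℤP.*-zeroʳ c)
  lincomb-scale c ((a , g , _) ∷ cs) w =
    trans (cong (λ z → c ℤ.* a ℤ.* g w ℤ.+ z) (lincomb-scale c cs w))
          (solve 4 (λ c a x l → c :* a :* x :+ c :* l := c :* (a :* x :+ l)) refl c a (g w) (lincomb G cs w))
    where open +-*-Solver

  lincomb-++ : ∀ {Gen} (cs ds : Combination Gen) w → lincomb G (cs ++ ds) w ≡ lincomb G cs w ℤ.+ lincomb G ds w
  lincomb-++ []                 ds w = sym (ℤP.+-identityˡ _)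
  lincomb-++ ((c , g , _) ∷ cs) ds w =
    trans (cong (λ z → c ℤ.* g w ℤ.+ z) (lincomb-++ cs ds w)) (sym (ℤP.+-assoc (c ℤ.* g w) _ _))

  Span-resp-≗ : ∀ {Gen f g} → (∀ w → f w ≡ g w) → Span G Gen f → Span G Gen g
  Span-resp-≗ f≗g (cs , f≗cs) = cs , λ w → trans (sym (f≗g w)) (f≗cs w)

  Span-generator : ∀ {Gen g} → Gen g → Span G Gen g
  Span-generator {g = g} generator =
    (+ 1 , g , generator) ∷ [] , λ w → sym (trans (ℤP.+-identityʳ _) (ℤP.*-identityˡ (g w)))

  Span-linear : ∀ {Gen f g} c → Span G Gen f → Span G Gen g → Span G Gen (λ w → c ℤ.* f w ℤ.+ g w)
  Span-linear {f = f} {g} c (cs , f≗cs) (ds , g≗ds) = scale c cs ++ ds , λ w → begin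
    c ℤ.* f w ℤ.+ g w                               ≡⟨ cong₂ (λ x y → c ℤ.* x ℤ.+ y) (f≗cs w) (g≗ds w) ⟩
    c ℤ.* lincomb G cs w ℤ.+ lincomb G ds w         ≡⟨ cong (ℤ._+ lincomb G ds w) (sym (lincomb-scale c cs w)) ⟩
    lincomb G (scale c cs) w ℤ.+ lincomb G ds w     ≡⟨ sym (lincomb-++ (scale c cs) ds w) ⟩
    lincomb G (scale c cs ++ ds) w                  ∎
    where open ≡-Reasoning

  record IsLinear (F : (W → ℤ) → W → ℤ) : Set where
    field
      cong-≗  : ∀ {f g} → (∀ w → f w ≡ g w) → ∀ w → F f w ≡ F g w
      at-zero : ∀ w → F (λ _ → + 0) w ≡ + 0
      linear  : ∀ c f g w → F (λ v → c ℤ.* f v ℤ.+ g v) w ≡ c ℤ.* F f w ℤ.+ F g w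

  id-isLinear : IsLinear id
  id-isLinear = record { cong-≗ = id ; at-zero = λ _ → refl ; linear = λ _ _ _ _ → refl }

  Span-map : ∀ {Gen Gen′ F} → IsLinear F → (∀ {g} → Gen g → Span G Gen′ (F g)) →
             ∀ {f} → Span G Gen f → Span G Gen′ (F f)
  Span-map {Gen} {Gen′} {F} F-linear F[gen]∈span (cs , f≗cs) =
    Span-resp-≗ (λ w → sym (cong-≗ f≗cs w)) (image cs)
    where
    open IsLinear F-linear
    image : ∀ (cs : Combination Gen) → Span G Gen′ (F (lincomb G cs))
    image []                         = [] , at-zero
    image ((c , g , generator) ∷ cs) =
      Span-resp-≗ (λ w → sym (linear c g (lincomb G cs) w)) (Span-linear c (F[gen]∈span generator) (image cs))

  Span-bind : ∀ {Gen Gen′} → (∀ {g} → Gen g → Span G Gen′ g) → ∀ {f} → Span G Gen f → Span G Gen′ f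
  Span-bind = Span-map id-isLinear

module Convolution (G : FinGroup) where
  open FinGroup G
  open SpanProperties G
  open +-*-Solver

  conv-cong : ∀ {f f′ g g′} → (∀ v → f v ≡ f′ v) → (∀ v → g v ≡ g′ v) → ∀ w → conv G f g w ≡ conv G f′ g′ w
  conv-cong f≗f′ g≗g′ w = ∑-cong size (λ i → cong₂ ℤ._*_ (f≗f′ (enum i)) (g≗g′ (inv (enum i) · w)))

  conv-linearˡ : ∀ h → IsLinear (λ f → conv G f h)
  conv-linearˡ h = record
    { cong-≗ = λ {f} {g} f≗g → conv-cong {f} {g} {h} {h} f≗g (λ _ → refl)
    ; at-zero = λ w → ∑-zero size _ (λ i → ℤP.*-zeroˡ (h (inv (enum i) · w)))
    ; linear = λ c f g w → trans (∑-cong size (λ i → distrib c (f (enum i)) (g (enum i)) (h (inv (enum i) · w))))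
                                 (∑-linear size c _ _) }
    where
    distrib : ∀ c x y z → (c ℤ.* x ℤ.+ y) ℤ.* z ≡ c ℤ.* (x ℤ.* z) ℤ.+ y ℤ.* z
    distrib = solve 4 (λ c x y z → (c :* x :+ y) :* z := c :* (x :* z) :+ y :* z) refl

  conv-linearʳ : ∀ f → IsLinear (conv G f)
  conv-linearʳ f = record
    { cong-≗ = λ {g} {h} → conv-cong {f} {f} {g} {h} (λ _ → refl)
    ; at-zero = λ w → ∑-zero size _ (λ i → ℤP.*-zeroʳ (f (enum i)))
    ; linear = λ c g h w → trans (∑-cong size (λ i → distrib c (f (enum i)) (g (inv (enum i) · w)) (h (inv (enum i) · w))))
                                 (∑-linear size c _ _) }
    where
    distrib : ∀ c x y z → x ℤ.* (c ℤ.* y ℤ.+ z) ≡ c ℤ.* (x ℤ.* y) ℤ.+ x ℤ.* z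
    distrib = solve 4 (λ c x y z → x :* (c :* y :+ z) := c :* (x :* y) :+ x :* z) refl

  Span-conv : ∀ {Gen₁ Gen₂ Gen} → (∀ {g₁ g₂} → Gen₁ g₁ → Gen₂ g₂ → Span G Gen (conv G g₁ g₂)) →
              ∀ {f₁ f₂} → Span G Gen₁ f₁ → Span G Gen₂ f₂ → Span G Gen (conv G f₁ f₂)
  Span-conv generators∈span {f₂ = f₂} f₁∈span f₂∈span =
    Span-map (conv-linearˡ f₂) (λ {g₁} g₁∈Gen₁ → Span-map (conv-linearʳ g₁) (generators∈span g₁∈Gen₁) f₂∈span) f₁∈span

module DirectProduct (G : FinGroup) {U₁ U₂ : FinGroup.W G → Set}
  (U₁-subgroup : IsSubgroup G U₁) (U₂-subgroup : IsSubgroup G U₂)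
  (U₁×U₂ : InternalDirectProduct G U₁ U₂) where
  open FinGroup G
  open FinGroupProperties G
  open ≡-Reasoning
  module U₁ = IsSubgroup U₁-subgroup
  module U₂ = IsSubgroup U₂-subgroup

  commute : ∀ {x y} → U₁ x → U₂ y → x · y ≡ y · x
  commute = proj₁ U₁×U₂ _ _

  ∩-trivial : ∀ {x} → U₁ x → U₂ x → x ≡ e
  ∩-trivial = proj₁ (proj₂ U₁×U₂) _

  π₁ π₂ : W → W
  π₁ w = proj₁ (proj₂ (proj₂ U₁×U₂) w)
  π₂ w = proj₁ (proj₂ (proj₂ (proj₂ U₁×U₂) w))

  π₁∈U₁ : ∀ w → U₁ (π₁ w)
  π₁∈U₁ w = proj₁ (proj₂ (proj₂ (proj₂ (proj₂ U₁×U₂) w)))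

  π₂∈U₂ : ∀ w → U₂ (π₂ w)
  π₂∈U₂ w = proj₁ (proj₂ (proj₂ (proj₂ (proj₂ (proj₂ U₁×U₂) w))))

  π₁·π₂ : ∀ w → w ≡ π₁ w · π₂ w
  π₁·π₂ w = proj₂ (proj₂ (proj₂ (proj₂ (proj₂ (proj₂ U₁×U₂) w))))

  swapped : InternalDirectProduct G U₂ U₁
  swapped = (λ y x y∈U₂ x∈U₁ → sym (commute x∈U₁ y∈U₂)) ,
            (λ x x∈U₂ x∈U₁ → ∩-trivial x∈U₁ x∈U₂) ,
            (λ w → π₂ w , π₁ w , π₂∈U₂ w , π₁∈U₁ w , trans (π₁·π₂ w) (commute (π₁∈U₁ w) (π₂∈U₂ w)))

  factorisation-unique : ∀ {a b a′ b′} → U₁ a → U₂ b → U₁ a′ → U₂ b′ → a · b ≡ a′ · b′ → a ≡ a′ × b ≡ b′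
  factorisation-unique {a} {b} {a′} {b′} a∈U₁ b∈U₂ a′∈U₁ b′∈U₂ ab≡a′b′ = a≡a′ , b≡b′
    where
    a′⁻¹a≡b′b⁻¹ : inv a′ · a ≡ b′ · inv b
    a′⁻¹a≡b′b⁻¹ = begin
      inv a′ · a                      ≡⟨ sym (//-rightDividesʳ b _) ⟩
      ((inv a′ · a) · b) · inv b      ≡⟨ cong (_· inv b) (assoc _ _ _) ⟩
      (inv a′ · (a · b)) · inv b      ≡⟨ cong (λ z → (inv a′ · z) · inv b) ab≡a′b′ ⟩
      (inv a′ · (a′ · b′)) · inv b    ≡⟨ cong (_· inv b) (\\-leftDividesʳ a′ b′) ⟩
      b′ · inv b                      ∎
    a′⁻¹a≡e : inv a′ · a ≡ e
    a′⁻¹a≡e = ∩-trivial (U₁.·-closed (U₁.inv-closed a′∈U₁) a∈U₁)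
                        (subst U₂ (sym a′⁻¹a≡b′b⁻¹) (U₂.·-closed b′∈U₂ (U₂.inv-closed b∈U₂)))
    a≡a′ : a ≡ a′
    a≡a′ = begin
      a                   ≡⟨ sym (\\-leftDividesˡ a′ a) ⟩
      a′ · (inv a′ · a)   ≡⟨ cong (a′ ·_) a′⁻¹a≡e ⟩
      a′ · e              ≡⟨ idʳ a′ ⟩
      a′                  ∎
    b≡b′ : b ≡ b′
    b≡b′ = ∙-cancelˡ a b b′ (trans ab≡a′b′ (cong (_· b′) (sym a≡a′)))

  U₁? : Decidable U₁
  U₁? x = map′
    (λ π₂x≡e → subst U₁ (sym (trans (π₁·π₂ x) (trans (cong (π₁ x ·_) π₂x≡e) (idʳ _)))) (π₁∈U₁ x))
    (λ x∈U₁ → sym (proj₂ (factorisation-unique x∈U₁ U₂.e-closed (π₁∈U₁ x) (π₂∈U₂ x) (trans (idʳ x) (π₁·π₂ x)))))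
    (π₂ x ≟ e)

  normal : Normal U₁
  normal g {u} u∈U₁ = subst U₁ (sym gug⁻¹≡aua⁻¹) (U₁.·-closed (U₁.·-closed (π₁∈U₁ g) u∈U₁) (U₁.inv-closed (π₁∈U₁ g)))
    where
    a b : W
    a = π₁ g
    b = π₂ g
    gug⁻¹≡aua⁻¹ : g · u · inv g ≡ a · u · inv a
    gug⁻¹≡aua⁻¹ = begin
      g · u · inv g                ≡⟨ cong (λ z → z · u · inv z) (π₁·π₂ g) ⟩
      a · b · u · inv (a · b)      ≡⟨ cong (a · b · u ·_) (⁻¹-anti-homo-∙ a b) ⟩
      a · b · u · (inv b · inv a)  ≡⟨ cong (_· (inv b · inv a)) (assoc a b u) ⟩
      a · (b · u) · (inv b · inv a) ≡⟨ cong (λ z → a · z · (inv b · inv a)) (sym (commute u∈U₁ (π₂∈U₂ g))) ⟩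
      a · (u · b) · (inv b · inv a) ≡⟨ cong (_· (inv b · inv a)) (sym (assoc a u b)) ⟩
      a · u · b · (inv b · inv a)  ≡⟨ assoc _ _ _ ⟩
      a · u · (b · (inv b · inv a)) ≡⟨ cong (a · u ·_) (\\-leftDividesˡ b (inv a)) ⟩
      a · u · inv a                ∎

  conv-factor : ∀ {f₁ f₂} → (∀ {v} → ¬ U₁ v → f₁ v ≡ + 0) → (∀ {v} → ¬ U₂ v → f₂ v ≡ + 0) →
                ∀ w → conv G f₁ f₂ w ≡ f₁ (π₁ w) ℤ.* f₂ (π₂ w)
  conv-factor {f₁} {f₂} f₁-support f₂-support w = begin
    conv G f₁ f₂ w                                     ≡⟨ ∑-single size _ (index (π₁ w)) vanishes ⟩
    f₁ (enum (index (π₁ w))) ℤ.* f₂ (inv (enum (index (π₁ w))) · w)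
      ≡⟨ cong (λ x → f₁ x ℤ.* f₂ (inv x · w)) (enum-index (π₁ w)) ⟩
    f₁ (π₁ w) ℤ.* f₂ (inv (π₁ w) · w)                  ≡⟨ cong (λ v → f₁ (π₁ w) ℤ.* f₂ (inv (π₁ w) · v)) (π₁·π₂ w) ⟩
    f₁ (π₁ w) ℤ.* f₂ (inv (π₁ w) · (π₁ w · π₂ w))      ≡⟨ cong (λ v → f₁ (π₁ w) ℤ.* f₂ v) (\\-leftDividesʳ (π₁ w) (π₂ w)) ⟩
    f₁ (π₁ w) ℤ.* f₂ (π₂ w)                            ∎
    where
    -- The term of x vanishes unless x ∈ U₁ and x⁻¹w ∈ U₂, i.e. unless x = π₁ w.
    vanishes : ∀ i → i ≢ index (π₁ w) → f₁ (enum i) ℤ.* f₂ (inv (enum i) · w) ≡ + 0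
    vanishes i i≢ = ≡-by-cases (U₁ x)
      (λ x∈U₁ → ≡-by-cases (U₂ (inv x · w))
        (λ x⁻¹w∈U₂ → contradiction (x≡π₁w x∈U₁ x⁻¹w∈U₂) (λ x≡π₁w → i≢ (trans (sym (index-enum i)) (cong index x≡π₁w))))
        (λ x⁻¹w∉U₂ → trans (cong (f₁ x ℤ.*_) (f₂-support x⁻¹w∉U₂)) (ℤP.*-zeroʳ (f₁ x))))
      (λ x∉U₁ → cong (ℤ._* f₂ (inv x · w)) (f₁-support x∉U₁))
      where
      x : W
      x = enum i
      x≡π₁w : U₁ x → U₂ (inv x · w) → x ≡ π₁ w
      x≡π₁w x∈U₁ x⁻¹w∈U₂ = proj₁ (factorisation-unique x∈U₁ x⁻¹w∈U₂ (π₁∈U₁ w) (π₂∈U₂ w)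
                                    (trans (\\-leftDividesˡ x w) (π₁·π₂ w)))

module FactorLengths (G : FinGroup) {X : FinGroup.W G → Set} (X? : Decidable X)
  (X-generates : ∀ w → InGen G X w)
  {U₁ U₂ : FinGroup.W G → Set} (U₁-subgroup : IsSubgroup G U₁) (U₂-subgroup : IsSubgroup G U₂)
  (U₁×U₂ : InternalDirectProduct G U₁ U₂) (X⊆U₁∪U₂ : ∀ {s} → X s → U₁ s ⊎ U₂ s) where
  open FinGroup G
  open FinGroupProperties G
  open DirectProduct G U₁-subgroup U₂-subgroup U₁×U₂
  open ≡-Reasoning

  X₁ X₂ : W → Set
  X₁ s = X s × U₁ s
  X₂ s = X s × U₂ s

  record SplitWord (ws : List W) : Set where
    field
      left      : List W
      right     : List W
      left∈X₁   : All X₁ left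
      right∈X₂  : All X₂ right
      length-+  : length left + length right ≡ length ws
      prod-·    : prod G ws ≡ prod G left · prod G right

  split-word : ∀ {ws} → All X ws → SplitWord ws
  split-word [] = record
    { left = [] ; right = [] ; left∈X₁ = [] ; right∈X₂ = [] ; length-+ = refl ; prod-· = sym (idˡ e) }
  split-word {s ∷ ws} (s∈X ∷ ws∈X) with split-word ws∈X | X⊆U₁∪U₂ s∈X
  ... | record { left = L ; right = R ; left∈X₁ = L∈X₁ ; right∈X₂ = R∈X₂ ; length-+ = len ; prod-· = ws≡LR }
      | inj₁ s∈U₁ = record
    { left = s ∷ L ; right = R ; left∈X₁ = (s∈X , s∈U₁) ∷ L∈X₁ ; right∈X₂ = R∈X₂
    ; length-+ = cong suc len ; prod-· = trans (cong (s ·_) ws≡LR) (sym (assoc _ _ _)) }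
  ... | record { left = L ; right = R ; left∈X₁ = L∈X₁ ; right∈X₂ = R∈X₂ ; length-+ = len ; prod-· = ws≡LR }
      | inj₂ s∈U₂ = record
    { left = L ; right = s ∷ R ; left∈X₁ = L∈X₁ ; right∈X₂ = (s∈X , s∈U₂) ∷ R∈X₂
    ; length-+ = trans (ℕP.+-suc _ _) (cong suc len)
    ; prod-· = begin
        s · prod G ws                  ≡⟨ cong (s ·_) ws≡LR ⟩
        s · (prod G L · prod G R)      ≡⟨ sym (assoc _ _ _) ⟩
        (s · prod G L) · prod G R      ≡⟨ cong (_· prod G R) (sym (commute (L∈U₁ L∈X₁) s∈U₂)) ⟩
        (prod G L · s) · prod G R      ≡⟨ assoc _ _ _ ⟩
        prod G L · (s · prod G R)      ∎ }
    where
    L∈U₁ : ∀ {L} → All X₁ L → U₁ (prod G L)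
    L∈U₁ L∈X₁ = U₁.prod-closed (All.map proj₂ L∈X₁)

  split-product : ∀ {x y N} → U₁ x → U₂ y → IsProductOf G X (x · y) N →
                  Σ ℕ λ m → Σ ℕ λ n → m + n ≡ N × IsProductOf G X₁ x m × IsProductOf G X₂ y n
  split-product {x} {y} x∈U₁ y∈U₂ (ws , ws∈X , refl , ws≡xy) =
    length L , length R , length-+ , (L , left∈X₁ , refl , sym x≡L) , (R , right∈X₂ , refl , sym y≡R)
    where
    open SplitWord (split-word ws∈X) renaming (left to L; right to R)
    x≡L×y≡R : x ≡ prod G L × y ≡ prod G R
    x≡L×y≡R = factorisation-unique x∈U₁ y∈U₂ (U₁.prod-closed (All.map proj₂ left∈X₁))
                (U₂.prod-closed (All.map proj₂ right∈X₂)) (trans (sym ws≡xy) prod-·)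
    x≡L : x ≡ prod G L
    x≡L = proj₁ x≡L×y≡R
    y≡R : y ≡ prod G R
    y≡R = proj₂ x≡L×y≡R

  join-product : ∀ {x y m n} → IsProductOf G X₁ x m → IsProductOf G X₂ y n → IsProductOf G X (x · y) (m + n)
  join-product (L , L∈X₁ , refl , refl) (R , R∈X₂ , refl , refl) =
    L ++ R , AllP.++⁺ (All.map proj₁ L∈X₁) (All.map proj₁ R∈X₂) , length-++ L , prod-++ L R

  length-split : ∀ {x y N} → U₁ x → U₂ y → HasLength G X (x · y) N →
                 Σ ℕ λ m → Σ ℕ λ n → m + n ≡ N × HasLength G X₁ x m × HasLength G X₂ y n
  length-split x∈U₁ y∈U₂ (xy∈Xᴺ , N-least) with split-product x∈U₁ y∈U₂ xy∈Xᴺ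
  ... | m , n , refl , x∈X₁ᵐ , y∈X₂ⁿ =
    m , n , refl ,
    (x∈X₁ᵐ , λ m′ x∈X₁ᵐ′ → ℕP.+-cancelʳ-≤ n m m′ (N-least _ (join-product x∈X₁ᵐ′ y∈X₂ⁿ))) ,
    (y∈X₂ⁿ , λ n′ y∈X₂ⁿ′ → ℕP.+-cancelˡ-≤ m n n′ (N-least _ (join-product x∈X₁ᵐ y∈X₂ⁿ′)))

  length-join : ∀ {x y m n} → U₁ x → U₂ y → HasLength G X₁ x m → HasLength G X₂ y n →
                HasLength G X (x · y) (m + n)
  length-join x∈U₁ y∈U₂ (x∈X₁ᵐ , m-least) (y∈X₂ⁿ , n-least) = join-product x∈X₁ᵐ y∈X₂ⁿ , minimal
    where
    minimal : ∀ N → IsProductOf G X _ N → _ ≤ N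
    minimal N xy∈Xᴺ with split-product x∈U₁ y∈U₂ xy∈Xᴺ
    ... | m′ , n′ , refl , x∈X₁ᵐ′ , y∈X₂ⁿ′ = ℕP.+-mono-≤ (m-least m′ x∈X₁ᵐ′) (n-least n′ y∈X₂ⁿ′)

  length₂ : ∀ {y} → U₂ y → Σ ℕ (HasLength G X₂ y)
  length₂ {y} y∈U₂ with X-generates (e · y)
  ... | _ , ey∈Xᵏ with split-product U₁.e-closed y∈U₂ ey∈Xᵏ
  ...   | _ , _ , _ , _ , y∈X₂ⁿ = hasLength (λ s → X? s ×-dec U₂? s) (_ , y∈X₂ⁿ)
    where open DirectProduct G U₂-subgroup U₁-subgroup swapped renaming (U₁? to U₂?)

  Shorter-factor : ∀ {x y r} → U₁ x → U₂ y → U₁ r → Shorter G X (x · y · r) (x · y) ⇔ Shorter G X₁ (x · r) x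
  Shorter-factor {x} {y} {r} x∈U₁ y∈U₂ r∈U₁ = mk⇔ to-factor from-factor
    where
    xyr≡xry : x · y · r ≡ x · r · y
    xyr≡xry = trans (assoc x y r) (trans (cong (x ·_) (sym (commute r∈U₁ y∈U₂))) (sym (assoc x r y)))
    xr∈U₁ : U₁ (x · r)
    xr∈U₁ = U₁.·-closed x∈U₁ r∈U₁
    to-factor : Shorter G X (x · y · r) (x · y) → Shorter G X₁ (x · r) x
    to-factor (M , N , ℓ[xyr]≡M , ℓ[xy]≡N , M<N)
      with length-split xr∈U₁ y∈U₂ (subst (λ v → HasLength G X v M) xyr≡xry ℓ[xyr]≡M)
         | length-split x∈U₁ y∈U₂ ℓ[xy]≡N
    ... | m₁ , n₁ , refl , ℓ[xr]≡m₁ , ℓ[y]≡n₁ | m₂ , n₂ , refl , ℓ[x]≡m₂ , ℓ[y]≡n₂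
      rewrite HasLength-unique ℓ[y]≡n₁ ℓ[y]≡n₂ =
      m₁ , m₂ , ℓ[xr]≡m₁ , ℓ[x]≡m₂ , ℕP.+-cancelʳ-< n₂ m₁ m₂ M<N
    from-factor : Shorter G X₁ (x · r) x → Shorter G X (x · y · r) (x · y)
    from-factor (m₁ , m₂ , ℓ[xr]≡m₁ , ℓ[x]≡m₂ , m₁<m₂) with length₂ y∈U₂
    ... | n , ℓ[y]≡n =
      m₁ + n , m₂ + n ,
      subst (λ v → HasLength G X v (m₁ + n)) (sym xyr≡xry) (length-join xr∈U₁ y∈U₂ ℓ[xr]≡m₁ ℓ[y]≡n) ,
      length-join x∈U₁ y∈U₂ ℓ[x]≡m₂ ℓ[y]≡n , ℕP.+-monoˡ-< n m₁<m₂

module FactorDescents (G : FinGroup) {X : FinGroup.W G → Set} (X? : Decidable X)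
  (X-generates : ∀ w → InGen G X w)
  {U₁ U₂ : FinGroup.W G → Set} (U₁-subgroup : IsSubgroup G U₁) (U₂-subgroup : IsSubgroup G U₂)
  (U₁×U₂ : InternalDirectProduct G U₁ U₂) (X⊆U₁∪U₂ : ∀ {s} → X s → U₁ s ⊎ U₂ s)
  {A : FinGroup.W G → Set} (A⊆U₁∪U₂ : ∀ {r} → A r → U₁ r ⊎ U₂ r) (e∉A : ¬ A (FinGroup.e G)) where
  open FinGroup G
  open DirectProduct G U₁-subgroup U₂-subgroup U₁×U₂
  open FactorLengths G X? X-generates U₁-subgroup U₂-subgroup U₁×U₂ X⊆U₁∪U₂ public
  module Swapped = FactorLengths G X? X-generates U₂-subgroup U₁-subgroup swapped (Sum.swap ∘ X⊆U₁∪U₂)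

  A₁ A₂ : W → Set
  A₁ r = A r × U₁ r
  A₂ r = A r × U₂ r

  Shorter-factor₂ : ∀ {x y r} → U₁ x → U₂ y → U₂ r → Shorter G X (x · y · r) (x · y) ⇔ Shorter G X₂ (y · r) y
  Shorter-factor₂ {x} {y} {r} x∈U₁ y∈U₂ r∈U₂ =
    subst (λ v → Shorter G X (v · r) v ⇔ Shorter G X₂ (y · r) y) (sym (commute x∈U₁ y∈U₂)) (Swapped.Shorter-factor y∈U₂ x∈U₁ r∈U₂)

  descent-factor : ∀ {x y I I₁ I₂} → U₁ x → U₂ y →
                   (∀ r → I r ⇔ (I₁ r ⊎ I₂ r)) → (∀ {r} → I₁ r → U₁ r) → (∀ {r} → I₂ r → U₂ r) →
                   DescentIs G X A (x · y) I ⇔ (DescentIs G X₁ A₁ x I₁ × DescentIs G X₂ A₂ y I₂)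
  descent-factor {x} {y} {I} {I₁} {I₂} x∈U₁ y∈U₂ I≐I₁∪I₂ I₁⊆U₁ I₂⊆U₂ = mk⇔ separate combine
    where
    factor₁ : ∀ {r} → U₁ r → Shorter G X (x · y · r) (x · y) ⇔ Shorter G X₁ (x · r) x
    factor₁ = Shorter-factor x∈U₁ y∈U₂
    factor₂ : ∀ {r} → U₂ r → Shorter G X (x · y · r) (x · y) ⇔ Shorter G X₂ (y · r) y
    factor₂ = Shorter-factor₂ x∈U₁ y∈U₂
    not-both : ∀ {r} → A r → U₁ r → U₂ r → ∀ {B : Set} → B
    not-both r∈A r∈U₁ r∈U₂ = ⊥-elim (e∉A (subst A (∩-trivial r∈U₁ r∈U₂) r∈A))
    separate : DescentIs G X A (x · y) I → DescentIs G X₁ A₁ x I₁ × DescentIs G X₂ A₂ y I₂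
    separate D = D₁ , D₂
      where
      D₁ : DescentIs G X₁ A₁ x I₁
      D₁ r = mk⇔
        (λ i₁ → let (r∈A , sh) = to (D r) (from (I≐I₁∪I₂ r) (inj₁ i₁)) in (r∈A , I₁⊆U₁ i₁) , to (factor₁ (I₁⊆U₁ i₁)) sh)
        (λ ((r∈A , r∈U₁) , sh) → [ id , (λ i₂ → not-both r∈A r∈U₁ (I₂⊆U₂ i₂)) ]′
                                    (to (I≐I₁∪I₂ r) (from (D r) (r∈A , from (factor₁ r∈U₁) sh))))
      D₂ : DescentIs G X₂ A₂ y I₂
      D₂ r = mk⇔
        (λ i₂ → let (r∈A , sh) = to (D r) (from (I≐I₁∪I₂ r) (inj₂ i₂)) in (r∈A , I₂⊆U₂ i₂) , to (factor₂ (I₂⊆U₂ i₂)) sh)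
        (λ ((r∈A , r∈U₂) , sh) → [ (λ i₁ → not-both r∈A (I₁⊆U₁ i₁) r∈U₂) , id ]′
                                    (to (I≐I₁∪I₂ r) (from (D r) (r∈A , from (factor₂ r∈U₂) sh))))
    combine : DescentIs G X₁ A₁ x I₁ × DescentIs G X₂ A₂ y I₂ → DescentIs G X A (x · y) I
    combine (D₁ , D₂) r = mk⇔
      (λ i → [ (λ i₁ → let ((r∈A , r∈U₁) , sh) = to (D₁ r) i₁ in r∈A , from (factor₁ r∈U₁) sh)
             , (λ i₂ → let ((r∈A , r∈U₂) , sh) = to (D₂ r) i₂ in r∈A , from (factor₂ r∈U₂) sh)
             ]′ (to (I≐I₁∪I₂ r) i))
      (λ (r∈A , sh) → from (I≐I₁∪I₂ r)
        ([ (λ r∈U₁ → inj₁ (from (D₁ r) ((r∈A , r∈U₁) , to (factor₁ r∈U₁) sh)))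
         , (λ r∈U₂ → inj₂ (from (D₂ r) ((r∈A , r∈U₂) , to (factor₂ r∈U₂) sh)))
         ]′ (A⊆U₁∪U₂ r∈A)))

  descent-factor-π : ∀ {w I I₁ I₂} →
                     (∀ r → I r ⇔ (I₁ r ⊎ I₂ r)) → (∀ {r} → I₁ r → U₁ r) → (∀ {r} → I₂ r → U₂ r) →
                     DescentIs G X A w I ⇔ (DescentIs G X₁ A₁ (π₁ w) I₁ × DescentIs G X₂ A₂ (π₂ w) I₂)
  descent-factor-π {w} {I} {I₁} {I₂} I≐I₁∪I₂ I₁⊆U₁ I₂⊆U₂ =
    subst (λ v → DescentIs G X A v I ⇔ (DescentIs G X₁ A₁ (π₁ w) I₁ × DescentIs G X₂ A₂ (π₂ w) I₂)) (sym (π₁·π₂ w))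
          (descent-factor (π₁∈U₁ w) (π₂∈U₂ w) I≐I₁∪I₂ I₁⊆U₁ I₂⊆U₂)

module CoxeterSystemProperties (G : FinGroup) (S : FinGroup.W G → Bool) (cox : IsCoxeterSystem G S) where
  open FinGroup G
  open FinGroupProperties G
  open IsCoxeterSystem cox
  open ≡-Reasoning

  Simple : W → Set
  Simple s = _∈ᵇ_ G s S

  simple-involution : ∀ {s} → Simple s → s · s ≡ e
  simple-involution {s} s∈S = proj₁ (involution s s∈S)

  simple≢e : ∀ {s} → Simple s → s ≢ e
  simple≢e {s} s∈S = proj₂ (involution s s∈S)

  -- A relation (s′t)ᵐ of odd m forces s′ and t to be conjugate, so "is conjugate to s"
  -- respects the Coxeter relations in ℤ₂.
  conjugacy-parity : ∀ s → Σ (W → Bool) λ φ →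
                     (∀ x y → φ (x · y) ≡ φ x xor φ y) × (∀ u → Simple u → φ u ≡ does (Conjugate? s u))
  conjugacy-parity s = presentation ℤ₂ conjugate? respects-relations
    where
    conjugate? : W → Bool
    conjugate? u = does (Conjugate? s u)

    respects-relations : ∀ s′ t → Simple s′ → Simple t → ∀ m → IsOrder G (s′ · t) m →
                         gpow ℤ₂ (conjugate? s′ xor conjugate? t) m ≡ false
    respects-relations s′ t s′∈S t∈S m (_ , [s′t]ᵐ≡e , _) with even-or-odd m
    ... | inj₁ (k , refl) = gpow-double _ k
    ... | inj₂ (k , refl) = subst (λ b → gpow ℤ₂ b (suc (k + k)) ≡ false) (sym same-class) (gpow-false (suc (k + k)))
      where
      s′~t : Conjugate s′ t
      s′~t = odd-order⇒conjugate k (simple-involution s′∈S) (simple-involution t∈S) [s′t]ᵐ≡e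
      same-class : conjugate? s′ xor conjugate? t ≡ false
      same-class = trans (cong (_xor conjugate? t)
                                (does-⇔ (mk⇔ (λ c → Conjugate-trans c s′~t) (λ c → Conjugate-trans c (Conjugate-sym s′~t)))
                                        (Conjugate? s s′) (Conjugate? s t)))
                         (xor-same (conjugate? t))

  conjugate-letter : ∀ {s} → Simple s → ∀ {ws} → All Simple ws → prod G ws ≡ s → Any (Conjugate s) ws
  conjugate-letter {s} s∈S {ws} ws∈S ws≡s = Any.map conjugate-if-true (true-letter ws∈S φ[ws]≡true)
    where
    φ : W → Bool
    φ = proj₁ (conjugacy-parity s)
    φ-hom : ∀ x y → φ (x · y) ≡ φ x xor φ y
    φ-hom = proj₁ (proj₂ (conjugacy-parity s))
    φ-simple : ∀ u → Simple u → φ u ≡ does (Conjugate? s u)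
    φ-simple = proj₂ (proj₂ (conjugacy-parity s))

    conjugate-if-true : ∀ {u} → does (Conjugate? s u) ≡ true → Conjugate s u
    conjugate-if-true {u} true≡ = decidable-stable (Conjugate? s u)
      (λ ¬s~u → contradiction (trans (sym (dec-false (Conjugate? s u) ¬s~u)) true≡) λ ())

    φ-e : φ e ≡ false
    φ-e = begin
      φ e             ≡⟨ cong φ (sym (idˡ e)) ⟩
      φ (e · e)       ≡⟨ φ-hom e e ⟩
      φ e xor φ e     ≡⟨ xor-same (φ e) ⟩
      false           ∎

    true-letter : ∀ {ws} → All Simple ws → φ (prod G ws) ≡ true → Any (λ u → does (Conjugate? s u) ≡ true) ws
    true-letter [] φe≡true = contradiction (trans (sym φ-e) φe≡true) (λ ())
    true-letter {u ∷ ws} (u∈S ∷ ws∈S) φ[u·ws]≡true with φ u in φu≡b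
    ... | true  = here (trans (sym (φ-simple u u∈S)) φu≡b)
    ... | false = there (true-letter ws∈S (begin
      φ (prod G ws)                 ≡⟨ cong (_xor φ (prod G ws)) (sym φu≡b) ⟩
      φ u xor φ (prod G ws)         ≡⟨ sym (φ-hom u (prod G ws)) ⟩
      φ (u · prod G ws)             ≡⟨ φ[u·ws]≡true ⟩
      true                          ∎))

    φ[ws]≡true : φ (prod G ws) ≡ true
    φ[ws]≡true = begin
      φ (prod G ws)          ≡⟨ cong φ ws≡s ⟩
      φ s                    ≡⟨ φ-simple s s∈S ⟩
      does (Conjugate? s s) ≡⟨ dec-true (Conjugate? s s) (Conjugate-refl s) ⟩
      true                   ∎

module ReducibleCoxeterSystem (G : FinGroup) (S : FinGroup.W G → Bool) (cox : IsCoxeterSystem G S)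
  (A : FinGroup.W G → Bool) (A⊆T : ∀ r → _∈ᵇ_ G r A → IsReflection G S r)
  (J₁ J₂ : FinGroup.W G → Bool)
  (J₁⊆S : ∀ s → _∈ᵇ_ G s J₁ → _∈ᵇ_ G s S) (J₂⊆S : ∀ s → _∈ᵇ_ G s J₂ → _∈ᵇ_ G s S)
  (W≅W₁×W₂ : InternalDirectProduct G (InGen G (λ x → _∈ᵇ_ G x J₁)) (InGen G (λ x → _∈ᵇ_ G x J₂))) where
  open FinGroup G
  open FinGroupProperties G
  open CoxeterSystemProperties G S cox
  open SpanProperties G
  open Convolution G
  open ClassSums G

  InA : W → Set
  InA r = _∈ᵇ_ G r A

  W₁ W₂ : W → Set
  W₁ = InGen G (λ x → _∈ᵇ_ G x J₁)
  W₂ = InGen G (λ x → _∈ᵇ_ G x J₂)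

  W₁-subgroup : IsSubgroup G W₁
  W₁-subgroup = InGen-isSubgroup (λ s s∈J₁ → simple-involution (J₁⊆S s s∈J₁))

  W₂-subgroup : IsSubgroup G W₂
  W₂-subgroup = InGen-isSubgroup (λ s s∈J₂ → simple-involution (J₂⊆S s s∈J₂))

  open DirectProduct G W₁-subgroup W₂-subgroup W≅W₁×W₂
  module Swapped = DirectProduct G W₂-subgroup W₁-subgroup swapped

  W₁? : Decidable W₁
  W₁? = U₁?

  W₂? : Decidable W₂
  W₂? = Swapped.U₁?

  W₁-normal : Normal W₁
  W₁-normal = normal

  W₂-normal : Normal W₂
  W₂-normal = Swapped.normal

  simple-split : ∀ {s} → Simple s → W₁ s ⊎ W₂ s
  simple-split {s} s∈S with π₁∈U₁ s | π₂∈U₂ s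
  ... | _ , ws₁ , ws₁∈J₁ , _ , ws₁≡π₁s | _ , ws₂ , ws₂∈J₂ , _ , ws₂≡π₂s =
    Sum.map (in-factor W₁-normal ws₁∈J₁) (in-factor W₂-normal ws₂∈J₂) (AnyP.++⁻ ws₁ conjugate-in-word)
    where
    conjugate-in-word : Any (Conjugate s) (ws₁ ++ ws₂)
    conjugate-in-word = conjugate-letter s∈S
      (AllP.++⁺ (All.map (λ {u} → J₁⊆S u) ws₁∈J₁) (All.map (λ {u} → J₂⊆S u) ws₂∈J₂))
      (trans (prod-++ ws₁ ws₂) (trans (cong₂ _·_ ws₁≡π₁s ws₂≡π₂s) (sym (π₁·π₂ s))))
    in-factor : ∀ {J : W → Set} → Normal (InGen G J) → ∀ {ws} → All J ws → Any (Conjugate s) ws → InGen G J s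
    in-factor J-normal ws∈J s~letter with All.lookupAny ws∈J s~letter
    ... | u∈J , s~u = Normal-conjugate J-normal s~u (1 , _ ∷ [] , u∈J ∷ [] , refl , idʳ _)

  reflection-split : ∀ {r} → InA r → W₁ r ⊎ W₂ r
  reflection-split {r} r∈A with A⊆T r r∈A
  ... | w , s , s∈S , refl = Sum.map (W₁-normal w) (W₂-normal w) (simple-split s∈S)

  e∉A : ¬ InA e
  e∉A e∈A with A⊆T e e∈A
  ... | w , s , s∈S , e≡wsw⁻¹ = simple≢e s∈S (∙-cancelˡ w s e ws≡we)
    where
    ws≡we : w · s ≡ w · e
    ws≡we = trans (inverseˡ-unique (w · s) (inv w) (sym e≡wsw⁻¹)) (trans (⁻¹-involutive w) (sym (idʳ w)))

  Simple? : Decidable Simple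
  Simple? s = S s Bool.≟ true

  open FactorDescents G Simple? (IsCoxeterSystem.generates cox) W₁-subgroup W₂-subgroup W≅W₁×W₂
                      simple-split reflection-split e∉A

  Gen Gen₁ Gen₂ : (W → ℤ) → Set₁
  Gen  = DescentGenerator G Simple (λ _ → ⊤) InA
  Gen₁ = DescentGenerator G X₁ W₁ A₁
  Gen₂ = DescentGenerator G X₂ W₂ A₂

  conv-indicates : ∀ {I I₁ I₂ g₁ g₂} → IsDescentClassSum G X₁ W₁ A₁ I₁ g₁ → IsDescentClassSum G X₂ W₂ A₂ I₂ g₂ →
                   (∀ r → I r ⇔ (I₁ r ⊎ I₂ r)) → (∀ {r} → I₁ r → W₁ r) → (∀ {r} → I₂ r → W₂ r) →
                   ∀ w → Indicates (DescentIs G Simple InA w I) (conv G g₁ g₂ w)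
  conv-indicates g₁-class g₂-class I≐I₁∪I₂ I₁⊆W₁ I₂⊆W₂ w =
    subst (Indicates _) (sym (conv-factor (classSum-vanishes g₁-class) (classSum-vanishes g₂-class) w))
      (Indicates-resp-⇔ (⇔.sym (descent-factor-π I≐I₁∪I₂ I₁⊆W₁ I₂⊆W₂))
        (Indicates-× (classSum-indicates g₁-class (π₁∈U₁ w)) (classSum-indicates g₂-class (π₂∈U₂ w))))

  generator-product : ∀ {g₁ g₂} → Gen₁ g₁ → Gen₂ g₂ → Gen (conv G g₁ g₂)
  generator-product (I₁ , (x , x∈W₁ , D₁) , g₁-class) (I₂ , (y , y∈W₂ , D₂) , g₂-class) =
    I , (x · y , tt , from (descent-factor x∈W₁ y∈W₂ I≐I₁∪I₂ I₁⊆W₁ I₂⊆W₂) (D₁ , D₂)) ,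
    classSum-intro (λ {w} _ → conv-indicates g₁-class g₂-class I≐I₁∪I₂ I₁⊆W₁ I₂⊆W₂ w) (λ ¬⊤ → ⊥-elim (¬⊤ tt))
    where
    I : W → Set
    I r = I₁ r ⊎ I₂ r
    I≐I₁∪I₂ : ∀ r → I r ⇔ (I₁ r ⊎ I₂ r)
    I≐I₁∪I₂ _ = ⇔.refl
    I₁⊆W₁ : ∀ {r} → I₁ r → W₁ r
    I₁⊆W₁ {r} i₁ = proj₂ (proj₁ (to (D₁ r) i₁))
    I₂⊆W₂ : ∀ {r} → I₂ r → W₂ r
    I₂⊆W₂ {r} i₂ = proj₂ (proj₁ (to (D₂ r) i₂))

  generator-factors : ∀ {g} → Gen g →
                      Σ (W → ℤ) λ g₁ → Σ (W → ℤ) λ g₂ → Gen₁ g₁ × Gen₂ g₂ × (∀ w → g w ≡ conv G g₁ g₂ w)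
  generator-factors {g} (I , (w₀ , _ , D₀) , g-class) =
    g₁ , g₂ , (I₁ , (x₀ , π₁∈U₁ w₀ , D₁x₀) , g₁-class) , (I₂ , (y₀ , π₂∈U₂ w₀ , D₂y₀) , g₂-class) ,
    λ w → Indicates-unique (classSum-indicates g-class tt) (conv-indicates g₁-class g₂-class I≐I₁∪I₂ proj₂ proj₂ w)
    where
    x₀ y₀ : W
    x₀ = π₁ w₀
    y₀ = π₂ w₀
    I₁ I₂ : W → Set
    I₁ r = I r × W₁ r
    I₂ r = I r × W₂ r
    I≐I₁∪I₂ : ∀ r → I r ⇔ (I₁ r ⊎ I₂ r)
    I≐I₁∪I₂ r = mk⇔ (λ i → Sum.map (i ,_) (i ,_) (reflection-split (proj₁ (to (D₀ r) i)))) [ proj₁ , proj₁ ]′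
    factor : ∀ {x y} → W₁ x → W₂ y →
             DescentIs G Simple InA (x · y) I ⇔ (DescentIs G X₁ A₁ x I₁ × DescentIs G X₂ A₂ y I₂)
    factor x∈W₁ y∈W₂ = descent-factor x∈W₁ y∈W₂ I≐I₁∪I₂ proj₂ proj₂
    D₁x₀ : DescentIs G X₁ A₁ x₀ I₁
    D₁x₀ = proj₁ (to (descent-factor-π I≐I₁∪I₂ proj₂ proj₂) D₀)
    D₂y₀ : DescentIs G X₂ A₂ y₀ I₂
    D₂y₀ = proj₂ (to (descent-factor-π I≐I₁∪I₂ proj₂ proj₂) D₀)
    -- On the slice W₁y₀ (resp. x₀W₂), g is the class sum of I₁ (resp. I₂), because the other
    -- component y₀ (resp. x₀) of w₀ already has descent set I₂ (resp. I₁).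
    g₁ g₂ : W → ℤ
    g₁ = restrict W₁? (λ x → g (x · y₀))
    g₂ = restrict W₂? (λ y → g (x₀ · y))
    g₁-class : IsDescentClassSum G X₁ W₁ A₁ I₁ g₁
    g₁-class = classSum-intro
      (λ x∈W₁ → subst (Indicates _) (sym (restrict-∈ W₁? (λ x → g (x · y₀)) x∈W₁))
                  (Indicates-resp-⇔ (⇔.trans (factor x∈W₁ (π₂∈U₂ w₀)) (mk⇔ proj₁ (_, D₂y₀)))
                    (classSum-indicates g-class tt)))
      (restrict-∉ W₁? (λ x → g (x · y₀)))
    g₂-class : IsDescentClassSum G X₂ W₂ A₂ I₂ g₂
    g₂-class = classSum-intro
      (λ y∈W₂ → subst (Indicates _) (sym (restrict-∈ W₂? (λ y → g (x₀ · y)) y∈W₂))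
                  (Indicates-resp-⇔ (⇔.trans (factor (π₁∈U₁ w₀) y∈W₂) (mk⇔ proj₂ (D₁x₀ ,_)))
                    (classSum-indicates g-class tt)))
      (restrict-∉ W₂? (λ y → g (x₀ · y)))

  descentModule⊆tensor : ∀ {f} → DescentModule G Simple (λ _ → ⊤) InA f →
                         TensorImage G (DescentModule G X₁ W₁ A₁) (DescentModule G X₂ W₂ A₂) f
  descentModule⊆tensor = Span-bind λ g∈Gen →
    let g₁ , g₂ , g₁∈Gen₁ , g₂∈Gen₂ , g≗g₁*g₂ = generator-factors g∈Gen
    in Span-generator (g₁ , g₂ , Span-generator g₁∈Gen₁ , Span-generator g₂∈Gen₂ , g≗g₁*g₂)

  tensor⊆descentModule : ∀ {f} → TensorImage G (DescentModule G X₁ W₁ A₁) (DescentModule G X₂ W₂ A₂) f →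
                         DescentModule G Simple (λ _ → ⊤) InA f
  tensor⊆descentModule = Span-bind λ (f₁ , f₂ , f₁∈span , f₂∈span , h≗f₁*f₂) →
    Span-resp-≗ (λ w → sym (h≗f₁*f₂ w))
      (Span-conv (λ g₁∈Gen₁ g₂∈Gen₂ → Span-generator (generator-product g₁∈Gen₁ g₂∈Gen₂)) f₁∈span f₂∈span)

corollary1p6 :
  (G : FinGroup) →
  let open FinGroup G in
  (S : W → Bool) → IsCoxeterSystem G S →
  (A : W → Bool) → (∀ r → _∈ᵇ_ G r A → IsReflection G S r) →
  (J₁ J₂ : W → Bool) →
  (∀ s → _∈ᵇ_ G s J₁ → _∈ᵇ_ G s S) →
  (∀ s → _∈ᵇ_ G s J₂ → _∈ᵇ_ G s S) →
  InternalDirectProduct G (InGen G (λ x → _∈ᵇ_ G x J₁)) (InGen G (λ x → _∈ᵇ_ G x J₂)) →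
  (f : W → ℤ) →
  DescentModule G (λ x → _∈ᵇ_ G x S) (λ _ → ⊤) (λ r → _∈ᵇ_ G r A) f
  ⇔ TensorImage G
      (DescentModule G
        (λ x → _∈ᵇ_ G x S × InGen G (λ y → _∈ᵇ_ G y J₁) x)
        (InGen G (λ y → _∈ᵇ_ G y J₁))
        (λ r → _∈ᵇ_ G r A × InGen G (λ y → _∈ᵇ_ G y J₁) r))
      (DescentModule G
        (λ x → _∈ᵇ_ G x S × InGen G (λ y → _∈ᵇ_ G y J₂) x)
        (InGen G (λ y → _∈ᵇ_ G y J₂))
        (λ r → _∈ᵇ_ G r A × InGen G (λ y → _∈ᵇ_ G y J₂) r))
      f
corollary1p6 G S cox A A⊆T J₁ J₂ J₁⊆S J₂⊆S W≅W₁×W₂ f = mk⇔ descentModule⊆tensor tensor⊆descentModule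
  where open ReducibleCoxeterSystem G S cox A A⊆T J₁ J₂ J₁⊆S J₂⊆S W≅W₁×W₂
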